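{- Let $\tau$ be a positive integer such that $2^{2^\tau}-1$ has at least two distinct primitive prime divisors. For each $1\le j\le\tau$ let $p_j$ be a primitive prime divisor of $2^{2^j}-1$, let $q$ be a primitive prime divisor of $2^{2^\tau}-1$ with $q\neq p_\tau$, and let $P=p_1p_2\cdots p_\tau$. Let $b>2$ be an integer with $b\equiv 1\pmod P$, and suppose $b$ satisfies one of the following: (i) $b\equiv 0\pmod q$; (ii) $b\equiv 1\pmod q$; (iii) $b\not\equiv 0\pmod q$, $b\not\equiv1\pmod q$, and $\gcd(P,\operatorname{ord}_q(b))=1$. Then there exist infinitely many $b$-repunits that are Riesel numbers.
   Context: For a positive integer $m$, a prime $p$ is a primitive prime divisor of $2^m-1$ if $p\mid 2^m-1$ and $p\nmid 2^\mu-1$ for every positive integer $\mu<m$. $\operatorname{ord}_q(b)$ is the multiplicative order of $b$ modulo $q$. For $b\ge2$ and $t\ge1$, the $b$-repunit $1_b^{(t)}$ is $(b^t-1)/(b-1)$. A Riesel number is an odd positive integer $k$ such that $k\cdot 2^n-1$ is composite for all positive integers $n$. -}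

module Defs where

open import Data.Nat using (ℕ; zero; suc; _+_; _*_; _∸_; _^_; _≤_; _<_)
open import Data.Nat.DivMod using (_/_)
open import Data.Nat.Divisibility using (_∣_)
open import Data.Nat.Primality using (Prime; Composite)
open import Data.Product using (_×_)
open import Relation.Nullary using (¬_)

PrimitivePrimeDivisor : ℕ → ℕ → Set
PrimitivePrimeDivisor p m =
  Prime p × p ∣ (2 ^ m ∸ 1) × (∀ μ → 0 < μ → μ < m → ¬ (p ∣ (2 ^ μ ∸ 1)))

IsOrd : ℕ → ℕ → ℕ → Set
IsOrd q b k = 0 < k × q ∣ (b ^ k ∸ 1) × (∀ m → 0 < m → m < k → ¬ (q ∣ (b ^ m ∸ 1)))

prodFrom1 : (ℕ → ℕ) → ℕ → ℕ
prodFrom1 p zero = 1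
prodFrom1 p (suc n) = prodFrom1 p n * p (suc n)

-- b-repunit 1_b^(t) = (b^t - 1)/(b - 1), defined for b ≥ 2 (value 0 otherwise, never used)
repunit : ℕ → ℕ → ℕ
repunit zero t = 0
repunit (suc zero) t = 0
repunit (suc (suc c)) t = (suc (suc c) ^ t ∸ 1) / suc c

Odd : ℕ → Set
Odd k = ¬ (2 ∣ k)

Riesel : ℕ → Set
Riesel k = 0 < k × Odd k × (∀ n → 1 ≤ n → Composite (k * 2 ^ n ∸ 1))

{-# OPTIONS --safe #-}
module Submission where

-- Take k = 1_b^(t) with t odd, t ≡ -1 (mod P) and t ≡ 1 (mod d), where d is 1, q or
-- ord_q(b) in cases (i), (ii), (iii): in each case t ≡ 1 (mod d) forces k ≡ 1 (mod q),
-- and gcd(P, d) = 1 makes the congruences on t solvable.  Since P ∣ b - 1 we also get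
-- k ≡ t ≡ -1 (mod P).  These two congruences cover every n ≥ 1: if n = 2^i · (odd)
-- with i < τ, then p_(i+1) divides the Fermat number 2^(2^i) + 1, hence 2^n + 1, hence
-- k · 2^n - 1; if 2^τ ∣ n, then q divides 2^n - 1 and hence k · 2^n - 1.  Taking t
-- large makes k exceed all of these primes, so each k · 2^n - 1 is composite.

open import Defs
open import Data.Nat
open import Data.Nat.Properties
open import Data.Nat.Divisibility
open import Data.Nat.DivMod using (_%_; _/_; _mod_; m≡m%n+[m/n]*n; m*n/n≡m)
open import Data.Nat.GCD using (gcd; module Bézout)
open import Data.Nat.Coprimality using (Coprime; coprime-Bézout; gcd≡1⇒coprime)
open import Data.Nat.Induction using (<-wellFounded)
open import Data.Nat.Primality
open import Data.Nat.Tactic.RingSolver using (solve-∀)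
open import Data.Fin as Fin using (toℕ)
open import Data.Fin.Properties using (pigeonhole; toℕ-fromℕ<)
open import Data.Product using (_×_; _,_; proj₁; proj₂; ∃-syntax)
open import Data.Sum using (_⊎_; inj₁; inj₂; [_,_]′; fromInj₁; fromInj₂)
open import Data.Empty using (⊥-elim)
open import Function using (_∘_; id)
open import Induction.WellFounded using (Acc; acc)
open import Relation.Binary.PropositionalEquality
open import Relation.Nullary using (¬_; Dec; yes; no; contradiction)
open import Relation.Nullary.Decidable using (_×-dec_)

infix 4 _≡1[mod_]
_≡1[mod_] : ℕ → ℕ → Set
x ≡1[mod q ] = ∃[ w ] x ≡ 1 + w * q

≡1[mod]⇒∣∸1 : ∀ {x q} → x ≡1[mod q ] → q ∣ x ∸ 1
≡1[mod]⇒∣∸1 (w , refl) = divides w refl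

∣∸1⇒≡1[mod] : ∀ {x q} → 0 < x → q ∣ x ∸ 1 → x ≡1[mod q ]
∣∸1⇒≡1[mod] {suc x} _ (divides w eq) = w , cong suc eq

∣⇒1+≡1[mod] : ∀ {x q} → q ∣ x → 1 + x ≡1[mod q ]
∣⇒1+≡1[mod] (divides w eq) = w , cong suc eq

≡1[mod]-* : ∀ {x y q} → x ≡1[mod q ] → y ≡1[mod q ] → x * y ≡1[mod q ]
≡1[mod]-* {q = q} (v , refl) (w , refl) = v + w + v * w * q , expand v w q
  where
  expand : ∀ v w q → (1 + v * q) * (1 + w * q) ≡ 1 + (v + w + v * w * q) * q
  expand = solve-∀

≡1[mod]-^ : ∀ {x q} → x ≡1[mod q ] → ∀ m → x ^ m ≡1[mod q ]
≡1[mod]-^ x≡1 zero    = 0 , refl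
≡1[mod]-^ x≡1 (suc m) = ≡1[mod]-* x≡1 (≡1[mod]-^ x≡1 m)

^-≡1[mod]-∣ : ∀ {a m n q} → a ^ m ≡1[mod q ] → m ∣ n → a ^ n ≡1[mod q ]
^-≡1[mod]-∣ {a} {m} {q = q} aᵐ≡1 (divides w refl) =
  subst (_≡1[mod q ]) (trans (^-*-assoc a m w) (cong (a ^_) (*-comm m w)))
        (≡1[mod]-^ aᵐ≡1 w)

prime∤1 : ∀ {p} → Prime p → ¬ p ∣ 1
prime∤1 p-prime p∣1 = nonTrivial⇒≢1 {{prime⇒nonTrivial p-prime}} (∣1⇒≡1 p∣1)

prime∣prime⇒≡ : ∀ {p q} → Prime p → Prime q → p ∣ q → p ≡ q
prime∣prime⇒≡ p-prime q-prime p∣q =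
  [ (λ p≡1 → contradiction (∣-reflexive p≡1) (prime∤1 p-prime)) , id ]′
    (prime⇒irreducible q-prime p∣q)

prime∤⇒coprime : ∀ {q n} → Prime q → ¬ q ∣ n → Coprime n q
prime∤⇒coprime q-prime q∤n (i∣n , i∣q) =
  [ id , (λ { refl → contradiction i∣n q∤n }) ]′ (prime⇒irreducible q-prime i∣q)

prime∤⇒∤^ : ∀ {q b} → Prime q → ¬ q ∣ b → ∀ i → ¬ q ∣ b ^ i
prime∤⇒∤^ q-prime q∤b zero    = prime∤1 q-prime
prime∤⇒∤^ q-prime q∤b (suc i) =
  [ q∤b , prime∤⇒∤^ q-prime q∤b i ]′ ∘ euclidsLemma _ _ q-prime

prime-divisor⇒composite : ∀ {r n} → Prime r → r < n → r ∣ n → Composite n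
prime-divisor⇒composite r-prime = hasNonTrivialDivisor {{prime⇒nonTrivial r-prime}}

parity-split : ∀ n → (∃[ m ] n ≡ m * 2) ⊎ (∃[ m ] n ≡ 1 + m * 2)
parity-split zero = inj₁ (0 , refl)
parity-split (suc n) with parity-split n
... | inj₁ (m , refl) = inj₂ (m , refl)
... | inj₂ (m , refl) = inj₁ (suc m , refl)

odd-suc : ∀ {m} → 2 ∣ m → Odd (suc m)
odd-suc {m} 2∣m 2∣1+m =
  contradiction (∣1⇒≡1 (∣m+n∣m⇒∣n (subst (2 ∣_) (+-comm 1 m) 2∣1+m) 2∣m)) λ ()

square∸1 : ∀ a → a * a ∸ 1 ≡ (a ∸ 1) * (a + 1)
square∸1 zero    = refl
square∸1 (suc a) = expand a
  where
  expand : ∀ a → a + a * suc a ≡ a * (suc a + 1)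
  expand = solve-∀

-- a^(e + 2) + 1 = a² (a^e + 1) - (a² - 1), and a + 1 ∣ a² - 1.
+1∣^odd+1 : ∀ a m → a + 1 ∣ a ^ (1 + m * 2) + 1
+1∣^odd+1 zero    m       = 1∣ _
+1∣^odd+1 (suc a) zero    =
  subst (λ x → suc a + 1 ∣ x + 1) (sym (*-identityʳ (suc a))) ∣-refl
+1∣^odd+1 (suc a) (suc m) =
  ∣m+n∣m⇒∣n (subst (suc a + 1 ∣_) (expand a (suc a ^ (1 + m * 2)))
                   (∣n⇒∣m*n (suc a * suc a) (+1∣^odd+1 (suc a) m)))
            (n∣m*n a)
  where
  expand : ∀ a x → suc a * suc a * (x + 1) ≡ a * (suc a + 1) + (suc a * (suc a * x) + 1)
  expand = solve-∀

2^2^[1+i]≡[2^2^i]² : ∀ i → 2 ^ 2 ^ suc i ≡ 2 ^ 2 ^ i * 2 ^ 2 ^ i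
2^2^[1+i]≡[2^2^i]² i =
  trans (cong (λ e → 2 ^ (2 ^ i + e)) (+-identityʳ (2 ^ i)))
        (^-distribˡ-+-* 2 (2 ^ i) (2 ^ i))

ppd⇒∣2^2^i+1 : ∀ {r} i → PrimitivePrimeDivisor r (2 ^ suc i) → r ∣ 2 ^ 2 ^ i + 1
ppd⇒∣2^2^i+1 {r} i (r-prime , r∣2^2^[1+i]∸1 , r-primitive) =
  fromInj₂ (⊥-elim ∘ r∤A∸1) (euclidsLemma (A ∸ 1) (A + 1) r-prime r∣[A∸1][A+1])
  where
  A = 2 ^ 2 ^ i
  r∣[A∸1][A+1] : r ∣ (A ∸ 1) * (A + 1)
  r∣[A∸1][A+1] =
    subst (r ∣_) (trans (cong (_∸ 1) (2^2^[1+i]≡[2^2^i]² i)) (square∸1 A)) r∣2^2^[1+i]∸1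
  r∤A∸1 : ¬ r ∣ A ∸ 1
  r∤A∸1 = r-primitive (2 ^ i) (m^n>0 2 i) (^-monoʳ-< 2 (s≤s (s≤s z≤n)) (n<1+n i))

2^2^i+1∣2^[2^i*odd]+1 : ∀ i m → 2 ^ 2 ^ i + 1 ∣ 2 ^ (2 ^ i * (1 + m * 2)) + 1
2^2^i+1∣2^[2^i*odd]+1 i m =
  subst (λ x → 2 ^ 2 ^ i + 1 ∣ x + 1) (^-*-assoc 2 (2 ^ i) (1 + m * 2))
        (+1∣^odd+1 (2 ^ 2 ^ i) m)

2-adic-split : ∀ τ n → 2 ^ τ ∣ n ⊎ ∃[ i ] ∃[ m ] (i < τ × n ≡ 2 ^ i * (1 + m * 2))
2-adic-split zero    n = inj₁ (1∣ n)
2-adic-split (suc τ) n with 2-adic-split τ n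
... | inj₂ (i , m , i<τ , n≡) = inj₂ (i , m , m<n⇒m<1+n i<τ , n≡)
... | inj₁ (divides w n≡) with parity-split w
...   | inj₁ (v , refl) = inj₁ (divides v (trans n≡ (*-assoc v 2 (2 ^ τ))))
...   | inj₂ (v , refl) = inj₂ (τ , v , n<1+n τ , trans n≡ (*-comm (1 + v * 2) (2 ^ τ)))

∣+1∧∣+1⇒∣*∸1 : ∀ {r k x} → r ∣ k + 1 → r ∣ x + 1 → r ∣ k * x ∸ 1
∣+1∧∣+1⇒∣*∸1 {r} {zero}  _ _ = r ∣0
∣+1∧∣+1⇒∣*∸1 {r} {suc k} {zero}  _ _ =
  subst (λ y → r ∣ y ∸ 1) (sym (*-zeroʳ (suc k))) (r ∣0)
∣+1∧∣+1⇒∣*∸1 {r} {suc k} {suc x} r∣k+1 r∣x+1 =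
  ∣m+n∣m⇒∣n (subst (r ∣_) (expand k x) (∣m⇒∣m*n (suc x + 1) r∣k+1))
            (∣m∣n⇒∣m+n r∣k+1 r∣x+1)
  where
  expand : ∀ k x → (suc k + 1) * (suc x + 1) ≡ (suc k + 1) + (suc x + 1) + (x + k * suc x)
  expand = solve-∀

<⇒<*2^∸1 : ∀ {r k n} → r < k → 0 < n → r < k * 2 ^ n ∸ 1
<⇒<*2^∸1 {k = suc k} {suc n} r<k _ =
  <-≤-trans r<k (≤-trans (s≤s (m≤m*n k 2)) (∸-monoˡ-≤ 1 (*-monoʳ-≤ (suc k) 2≤2^[1+n])))
  where
  2≤2^[1+n] : 2 ≤ 2 ^ suc n
  2≤2^[1+n] = *-monoʳ-≤ 2 (m^n>0 2 n)

%≡%⇒∣∸ : ∀ x y q .{{_ : NonZero q}} → x % q ≡ y % q → q ∣ y ∸ x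
%≡%⇒∣∸ x y q x%q≡y%q = divides (y / q ∸ x / q) (begin
  y ∸ x                                     ≡⟨ cong₂ _∸_ (m≡m%n+[m/n]*n y q) (m≡m%n+[m/n]*n x q) ⟩
  (y % q + y / q * q) ∸ (x % q + x / q * q) ≡⟨ cong (λ r → y′ ∸ (r + x / q * q)) x%q≡y%q ⟩
  (y % q + y / q * q) ∸ (y % q + x / q * q) ≡⟨ [m+n]∸[m+o]≡n∸o (y % q) _ _ ⟩
  y / q * q ∸ x / q * q                     ≡⟨ *-distribʳ-∸ q (y / q) (x / q) ⟨
  (y / q ∸ x / q) * q                       ∎)
  where
  open ≡-Reasoning
  y′ = y % q + y / q * q

equal-residues⇒∣^∸1 : ∀ {q b i j} .{{_ : NonZero q}} → Prime q → ¬ q ∣ b → i ≤ j →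
                      b ^ i % q ≡ b ^ j % q → q ∣ b ^ (j ∸ i) ∸ 1
equal-residues⇒∣^∸1 {q} {b} {i} {j} q-prime q∤b i≤j same-residue =
  fromInj₂ (⊥-elim ∘ prime∤⇒∤^ q-prime q∤b i)
    (euclidsLemma (b ^ i) _ q-prime (subst (q ∣_) bʲ∸bⁱ≡ (%≡%⇒∣∸ _ _ q same-residue)))
  where
  open ≡-Reasoning
  bʲ∸bⁱ≡ : b ^ j ∸ b ^ i ≡ b ^ i * (b ^ (j ∸ i) ∸ 1)
  bʲ∸bⁱ≡ = begin
    b ^ j ∸ b ^ i                   ≡⟨ cong (λ e → b ^ e ∸ b ^ i) (m+[n∸m]≡n i≤j) ⟨
    b ^ (i + (j ∸ i)) ∸ b ^ i       ≡⟨ cong (_∸ b ^ i) (^-distribˡ-+-* b i (j ∸ i)) ⟩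
    b ^ i * b ^ (j ∸ i) ∸ b ^ i     ≡⟨ cong (b ^ i * b ^ (j ∸ i) ∸_) (*-identityʳ (b ^ i)) ⟨
    b ^ i * b ^ (j ∸ i) ∸ b ^ i * 1 ≡⟨ *-distribˡ-∸ (b ^ i) (b ^ (j ∸ i)) 1 ⟨
    b ^ i * (b ^ (j ∸ i) ∸ 1)       ∎

∃-exponent≡1 : ∀ {q b} → Prime q → ¬ q ∣ b → ∃[ K ] (0 < K × q ∣ b ^ K ∸ 1)
∃-exponent≡1 {q} {b} q-prime q∤b =
  from-collision (pigeonhole (n<1+n q) (λ i → b ^ toℕ i mod q))
  where
  instance
    q≢0 : NonZero q
    q≢0 = prime⇒nonZero q-prime
  from-collision : (∃[ i ] ∃[ j ] (i Fin.< j × b ^ toℕ i mod q ≡ b ^ toℕ j mod q)) →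
                   ∃[ K ] (0 < K × q ∣ b ^ K ∸ 1)
  from-collision (i , j , i<j , same) =
    toℕ j ∸ toℕ i , m<n⇒0<n∸m i<j ,
    equal-residues⇒∣^∸1 q-prime q∤b (<⇒≤ i<j)
      (trans (sym (toℕ-fromℕ< _)) (trans (cong toℕ same) (toℕ-fromℕ< _)))

least-positive : ∀ {P : ℕ → Set} → (∀ n → Dec (P n)) → ∀ {K} → 0 < K → P K →
                 ∃[ k ] (0 < k × P k × (∀ m → 0 < m → m < k → ¬ P m))
least-positive {P} P? {K} = search K (<-wellFounded K)
  where
  search : ∀ K → Acc _<_ K → 0 < K → P K →
           ∃[ k ] (0 < k × P k × (∀ m → 0 < m → m < k → ¬ P m))
  search K (acc smaller) K>0 pK with anyUpTo? (λ n → (0 <? n) ×-dec P? n) K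
  ... | yes (n , n<K , n>0 , pn) = search n (smaller n<K) n>0 pn
  ... | no none = K , K>0 , pK , λ m m>0 m<K pm → none (m , m<K , m>0 , pm)

order-exists : ∀ {q b} → Prime q → ¬ q ∣ b → ∃[ k ] IsOrd q b k
order-exists {q} {b} q-prime q∤b =
  let K , K>0 , q∣bᴷ∸1 = ∃-exponent≡1 q-prime q∤b
  in least-positive (λ k → q ∣? b ^ k ∸ 1) K>0 q∣bᴷ∸1

∣prodFrom1 : ∀ (p : ℕ → ℕ) n {j} → 1 ≤ j → j ≤ n → p j ∣ prodFrom1 p n
∣prodFrom1 p zero    (s≤s _) ()
∣prodFrom1 p (suc n) 1≤j j≤1+n with m≤n⇒m<n∨m≡n j≤1+n
... | inj₁ j<1+n = ∣m⇒∣m*n (p (suc n)) (∣prodFrom1 p n 1≤j (s≤s⁻¹ j<1+n))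
... | inj₂ refl  = n∣m*n (prodFrom1 p n)

prodFrom1≢0 : ∀ (p : ℕ → ℕ) n → (∀ j → 1 ≤ j → j ≤ n → NonZero (p j)) →
              NonZero (prodFrom1 p n)
prodFrom1≢0 p zero    _   = _
prodFrom1≢0 p (suc n) p≢0 =
  m*n≢0 _ _ {{prodFrom1≢0 p n (λ j 1≤j j≤n → p≢0 j 1≤j (m≤n⇒m≤1+n j≤n))}}
            {{p≢0 (suc n) (s≤s z≤n) ≤-refl}}

prime∣prodFrom1⇒∣factor : ∀ {q} (p : ℕ → ℕ) n → Prime q → q ∣ prodFrom1 p n →
                          ∃[ j ] (1 ≤ j × j ≤ n × q ∣ p j)
prime∣prodFrom1⇒∣factor p zero    q-prime q∣1 = contradiction q∣1 (prime∤1 q-prime)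
prime∣prodFrom1⇒∣factor p (suc n) q-prime q∣P
  with euclidsLemma (prodFrom1 p n) (p (suc n)) q-prime q∣P
... | inj₁ q∣Pₙ =
  let j , 1≤j , j≤n , q∣pⱼ = prime∣prodFrom1⇒∣factor p n q-prime q∣Pₙ
  in j , 1≤j , m≤n⇒m≤1+n j≤n , q∣pⱼ
... | inj₂ q∣pₙ₊₁ = suc n , s≤s z≤n , ≤-refl , q∣pₙ₊₁

rep : ℕ → ℕ → ℕ
rep b zero    = 0
rep b (suc t) = 1 + b * rep b t

rep-geometric : ∀ c t → suc c ^ t ≡ 1 + rep (suc c) t * c
rep-geometric c zero    = refl
rep-geometric c (suc t) =
  trans (cong (suc c *_) (rep-geometric c t)) (expand c (rep (suc c) t))
  where
  expand : ∀ c r → (1 + c) * (1 + r * c) ≡ 1 + (1 + (1 + c) * r) * c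
  expand = solve-∀

repunit≡rep : ∀ c t → repunit (2 + c) t ≡ rep (2 + c) t
repunit≡rep c t rewrite rep-geometric (suc c) t = m*n/n≡m (rep (2 + c) t) (suc c)

rep≡t+*c : ∀ c t → ∃[ x ] rep (suc c) t ≡ t + x * c
rep≡t+*c c zero    = 0 , refl
rep≡t+*c c (suc t) =
  let x , eq = rep≡t+*c c t
  in x + t + x * c , trans (cong (λ r → 1 + (1 + c) * r) eq) (expand c t x)
  where
  expand : ∀ c t x → 1 + (1 + c) * (t + x * c) ≡ (1 + t) + (x + t + x * c) * c
  expand = solve-∀

t≤rep : ∀ c t → t ≤ rep (suc c) t
t≤rep c t = let x , eq = rep≡t+*c c t in subst (t ≤_) (sym eq) (m≤m+n t (x * c))

rep-∣+1 : ∀ {P c t} → P ∣ c → P ∣ t + 1 → P ∣ rep (suc c) t + 1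
rep-∣+1 {P} {c} {t} P∣c P∣t+1 =
  let x , eq = rep≡t+*c c t
  in subst (P ∣_) (trans (shuffle t (x * c)) (cong (_+ 1) (sym eq)))
       (∣m∣n⇒∣m+n P∣t+1 (∣n⇒∣m*n x P∣c))
  where
  shuffle : ∀ t y → t + 1 + y ≡ t + y + 1
  shuffle = solve-∀

rep-odd : ∀ b {t} → Odd t → Odd (rep b t)
rep-odd b {zero} t-odd = contradiction (2 ∣0) t-odd
rep-odd b {suc s} t-odd with parity-split b
... | inj₁ (B , refl) = odd-suc (∣m⇒∣m*n (rep (B * 2) s) (n∣m*n B))
... | inj₂ (B , refl) = λ 2∣rep →
  let x , eq = rep≡t+*c (B * 2) (suc s)
  in t-odd (∣m+n∣m⇒∣n (subst (2 ∣_) (trans eq (+-comm (suc s) (x * (B * 2)))) 2∣rep)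
                      (∣n⇒∣m*n x (n∣m*n B)))

RepunitStride : ℕ → ℕ → ℕ → Set
RepunitStride b q d = ∀ m → rep b (1 + m * d) ≡1[mod q ]

stride-of-∣base : ∀ {q b} → q ∣ b → ∀ d → RepunitStride b q d
stride-of-∣base {b = b} q∣b d m = ∣⇒1+≡1[mod] (∣m⇒∣m*n (rep b (m * d)) q∣b)

stride-of-∣base∸1 : ∀ {q c} → q ∣ c → RepunitStride (suc c) q q
stride-of-∣base∸1 {q} {c} q∣c m =
  let x , eq = rep≡t+*c c (1 + m * q)
  in subst (_≡1[mod q ]) (sym eq)
           (∣⇒1+≡1[mod] (∣m∣n⇒∣m+n (n∣m*n m) (∣n⇒∣m*n x q∣c)))

-- q ∣ b^(md) - 1 = 1_b^(md) · (b - 1) with q ∤ b - 1 gives q ∣ 1_b^(md).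
stride-of-order : ∀ {q c d} → Prime q → ¬ q ∣ c → suc c ^ d ≡1[mod q ] →
                  RepunitStride (suc c) q d
stride-of-order {q} {c} {d} q-prime q∤c bᵈ≡1 m =
  ∣⇒1+≡1[mod] (∣n⇒∣m*n (suc c)
    (fromInj₁ (⊥-elim ∘ q∤c) (euclidsLemma _ c q-prime q∣rep*c)))
  where
  q∣rep*c : q ∣ rep (suc c) (m * d) * c
  q∣rep*c =
    let w , eq = ^-≡1[mod]-∣ bᵈ≡1 (n∣m*n m)
    in divides w (suc-injective (trans (sym (rep-geometric c (m * d))) eq))

∃-coprime-stride : ∀ {P q c} → Prime q → ¬ q ∣ P →
  q ∣ suc c ⊎ q ∣ c ⊎
    (¬ q ∣ suc c × ¬ q ∣ c × (∀ k → IsOrd q (suc c) k → gcd P k ≡ 1)) →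
  ∃[ d ] (NonZero d × Coprime P d × RepunitStride (suc c) q d)
∃-coprime-stride q-prime q∤P (inj₁ q∣b) =
  1 , _ , (∣1⇒≡1 ∘ proj₂) , stride-of-∣base q∣b 1
∃-coprime-stride q-prime q∤P (inj₂ (inj₁ q∣c)) =
  _ , prime⇒nonZero q-prime , prime∤⇒coprime q-prime q∤P , stride-of-∣base∸1 q∣c
∃-coprime-stride q-prime q∤P (inj₂ (inj₂ (q∤b , q∤c , coprime-to-order))) =
  let o , o-ord@(o>0 , q∣bᵒ∸1 , _) = order-exists q-prime q∤b
  in o , >-nonZero o>0 , gcd≡1⇒coprime (coprime-to-order o o-ord) ,
     stride-of-order q-prime q∤c (∣∸1⇒≡1[mod] (m^n>0 (suc _) o) q∣bᵒ∸1)

coprime⇒∃y∣1+y*d : ∀ {P d} .{{_ : NonZero P}} → Coprime P d → ∃[ y ] P ∣ 1 + y * d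
coprime⇒∃y∣1+y*d {suc P′} {d} P⊥d with coprime-Bézout P⊥d
... | Bézout.+- x y eq = y , divides x eq
... | Bézout.-+ x y eq = y * P′ , divides (1 + P′ * x) (begin
  1 + y * P′ * d             ≡⟨ regroup y P′ d ⟩
  1 + P′ * (y * d)           ≡⟨ cong (λ z → 1 + P′ * z) eq ⟨
  1 + P′ * (1 + x * suc P′)  ≡⟨ factor P′ x ⟩
  (1 + P′ * x) * suc P′      ∎)
  where
  open ≡-Reasoning
  regroup : ∀ y P′ d → 1 + y * P′ * d ≡ 1 + P′ * (y * d)
  regroup = solve-∀
  factor : ∀ P′ x → 1 + P′ * (1 + x * suc P′) ≡ (1 + P′ * x) * suc P′
  factor = solve-∀

∃-large-exponent : ∀ {P d} .{{_ : NonZero P}} .{{_ : NonZero d}} → Coprime P d → ∀ L →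
                   ∃[ u ] (L < 1 + u * 2 * d × P ∣ 1 + u * 2 * d + 1)
∃-large-exponent {P} {d} P⊥d L =
  let y , P∣1+yd = coprime⇒∃y∣1+y*d P⊥d
      u = y + P * L
  in u , s≤s (begin
       L         ≤⟨ m≤n*m L P ⟩
       P * L     ≤⟨ m≤n+m (P * L) y ⟩
       u         ≤⟨ m≤m*n u 2 ⟩
       u * 2     ≤⟨ m≤m*n (u * 2) d ⟩
       u * 2 * d ∎)
     , subst (P ∣_) (expand y P L d) (∣m∣n⇒∣m+n (∣n⇒∣m*n 2 P∣1+yd) (m∣m*n (L * 2 * d)))
  where
  open ≤-Reasoning
  expand : ∀ y P L d → 2 * (1 + y * d) + P * (L * 2 * d) ≡ 1 + (y + P * L) * 2 * d + 1
  expand = solve-∀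

module _ (τ : ℕ) (p : ℕ → ℕ)
         (p-ppd : ∀ j → 1 ≤ j → j ≤ τ → PrimitivePrimeDivisor (p j) (2 ^ j)) where

  prodFrom1-ppd≢0 : NonZero (prodFrom1 p τ)
  prodFrom1-ppd≢0 = prodFrom1≢0 p τ λ j 1≤j j≤τ → prime⇒nonZero (proj₁ (p-ppd j 1≤j j≤τ))

  ppd∤prodFrom1 : ∀ {q} → PrimitivePrimeDivisor q (2 ^ τ) → q ≢ p τ → ¬ q ∣ prodFrom1 p τ
  ppd∤prodFrom1 {q} (q-prime , _ , q-primitive) q≢pτ q∣P
    with j , 1≤j , j≤τ , q∣pⱼ ← prime∣prodFrom1⇒∣factor p τ q-prime q∣P
    with prime∣prime⇒≡ q-prime (proj₁ (p-ppd j 1≤j j≤τ)) q∣pⱼ | m≤n⇒m<n∨m≡n j≤τ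
  ... | refl | inj₂ refl = q≢pτ refl
  ... | refl | inj₁ j<τ  =
    q-primitive (2 ^ j) (m^n>0 2 j) (^-monoʳ-< 2 (s≤s (s≤s z≤n)) j<τ)
                (proj₁ (proj₂ (p-ppd j 1≤j j≤τ)))

  riesel-of-covering : ∀ {q k} → PrimitivePrimeDivisor q (2 ^ τ) → Odd k →
                       prodFrom1 p τ < k → q < k →
                       prodFrom1 p τ ∣ k + 1 → k ≡1[mod q ] → Riesel k
  riesel-of-covering {q} {k} (q-prime , q∣2^2^τ∸1 , _) k-odd P<k q<k P∣k+1 k≡1 =
    ≤-trans (s≤s z≤n) q<k , k-odd , k2ⁿ∸1-composite
    where
    k2ⁿ∸1-composite : ∀ n → 1 ≤ n → Composite (k * 2 ^ n ∸ 1)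
    k2ⁿ∸1-composite n n>0 with 2-adic-split τ n
    ... | inj₁ 2^τ∣n =
      prime-divisor⇒composite q-prime (<⇒<*2^∸1 q<k n>0) (≡1[mod]⇒∣∸1 (≡1[mod]-* k≡1 2ⁿ≡1))
      where
      2ⁿ≡1 : 2 ^ n ≡1[mod q ]
      2ⁿ≡1 = ^-≡1[mod]-∣ (∣∸1⇒≡1[mod] (m^n>0 2 (2 ^ τ)) q∣2^2^τ∸1) 2^τ∣n
    ... | inj₂ (i , m , i<τ , refl) =
      prime-divisor⇒composite (proj₁ pᵢ₊₁-ppd)
        (<⇒<*2^∸1 (≤-<-trans (∣⇒≤ {{prodFrom1-ppd≢0}} pᵢ₊₁∣P) P<k) n>0)
        (∣+1∧∣+1⇒∣*∸1 (∣-trans pᵢ₊₁∣P P∣k+1)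
                      (∣-trans (ppd⇒∣2^2^i+1 i pᵢ₊₁-ppd) (2^2^i+1∣2^[2^i*odd]+1 i m)))
      where
      pᵢ₊₁-ppd = p-ppd (suc i) (s≤s z≤n) i<τ
      pᵢ₊₁∣P = ∣prodFrom1 p τ (s≤s z≤n) i<τ

  ∃-large-riesel-rep : ∀ {q c d} .{{_ : NonZero d}} → PrimitivePrimeDivisor q (2 ^ τ) →
                       prodFrom1 p τ ∣ c → Coprime (prodFrom1 p τ) d →
                       RepunitStride (suc c) q d →
                       ∀ N → ∃[ t ] (N ≤ t × Riesel (rep (suc c) t))
  ∃-large-riesel-rep {q} {c} {d} q-ppd P∣c P⊥d stride N =
    let u , N+P+q<t , P∣t+1 = ∃-large-exponent {{prodFrom1-ppd≢0}} P⊥d (N + P + q)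
        t = 1 + u * 2 * d
        N+P+q<k = <-≤-trans N+P+q<t (t≤rep c t)
    in t , ≤-trans (≤-trans (m≤m+n N P) (m≤m+n (N + P) q)) (<⇒≤ N+P+q<t) ,
       riesel-of-covering q-ppd (rep-odd (suc c) (odd-suc (∣m⇒∣m*n d (n∣m*n u))))
         (≤-<-trans (≤-trans (m≤n+m P N) (m≤m+n (N + P) q)) N+P+q<k)
         (≤-<-trans (m≤n+m q (N + P)) N+P+q<k)
         (rep-∣+1 {t = t} P∣c P∣t+1) (stride (u * 2))
    where
    P = prodFrom1 p τ

theorem3p13 :
    (τ : ℕ) → 1 ≤ τ →
    (∃[ r ] ∃[ s ] (r ≢ s × PrimitivePrimeDivisor r (2 ^ τ) × PrimitivePrimeDivisor s (2 ^ τ))) →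
    (p : ℕ → ℕ) → (∀ j → 1 ≤ j → j ≤ τ → PrimitivePrimeDivisor (p j) (2 ^ j)) →
    (q : ℕ) → PrimitivePrimeDivisor q (2 ^ τ) → q ≢ p τ →
    (b : ℕ) → 2 < b → prodFrom1 p τ ∣ (b ∸ 1) →
    (q ∣ b
      ⊎ q ∣ (b ∸ 1)
      ⊎ (¬ (q ∣ b) × ¬ (q ∣ (b ∸ 1)) × (∀ k → IsOrd q b k → gcd (prodFrom1 p τ) k ≡ 1))) →
    ∀ N → ∃[ t ] (N ≤ t × Riesel (repunit b t))
theorem3p13 τ _ _ p p-ppd q q-ppd q≢pτ (suc (suc c)) (s≤s (s≤s _)) P∣b∸1 cases N =
  let d , d≢0 , P⊥d , stride =
        ∃-coprime-stride (proj₁ q-ppd) (ppd∤prodFrom1 τ p p-ppd q-ppd q≢pτ) cases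
      t , N≤t , riesel = ∃-large-riesel-rep τ p p-ppd {{d≢0}} q-ppd P∣b∸1 P⊥d stride N
  in t , N≤t , subst Riesel (sym (repunit≡rep c t)) riesel
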